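{- Let $\mathbb{C}$ be a finite set of non-trivial clauses and let $N(\mathbb{C})$ be its negated configuration. Then $N(\mathbb{C})$ equals the set of all non-trivial clauses $C$ such that $\neg C \vDash \mathbb{C}$ and for every clause $C' \subsetneq C$ it holds that $\neg C' \nvDash \mathbb{C}$. Here $\neg C$ denotes the term (conjunction) of the negations of the literals of $C$, and $\mathbb{C}$ is identified with the CNF formula $\bigwedge_{D\in\mathbb{C}} D$.
   Context: A literal is a Boolean variable $x$ or its negation $\overline{x}$, with $\overline{\overline{x}}=x$. A clause is a disjunction (set) of literals; it is trivial if it contains a variable and its negation; $0$ denotes the empty clause, whose negation is the empty term (which is always true). A clause $C'$ subsumes a clause $C$ if every literal of $C'$ appears in $C$. The negated configuration $N(\mathbb{C})$ of a finite set of clauses $\mathbb{C}$ is defined by induction on $|\mathbb{C}|$: $N(\emptyset)=\{0\}$, and $N(\mathbb{C}\cup\{C\})=\{D\lor \overline{a} : D\in N(\mathbb{C}),\ a\in C\}$, where trivial clauses and clauses subsumed by other clauses are removed from the resulting set. $\vDash$ denotes logical implication. -}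

module Defs where

open import Data.Bool using (Bool; true; false; not; _∧_)
import Data.Bool.Properties as BoolP
open import Data.Nat using (ℕ)
import Data.Nat.Properties as NatP
open import Data.Product using (Σ; _×_; _,_)
open import Data.Product.Properties using (≡-dec)
open import Data.List using (List; []; _∷_; [_]; _++_; map; concatMap; filterᵇ)
open import Data.Bool.ListAction using (any; all)
open import Data.List.Relation.Unary.Any using (Any)
open import Data.List.Relation.Unary.All using (All)
open import Relation.Binary.PropositionalEquality using (_≡_)
open import Relation.Binary.Definitions using (DecidableEquality)
open import Relation.Nullary using (¬_; does)

-- A literal: (polarity , variable).  (true , x) is x, (false , x) is x̄.
Literal : Set
Literal = Bool × ℕ

neg : Literal → Literal
neg (b , x) = (not b , x)

_≟L_ : DecidableEquality Literal
_≟L_ = ≡-dec BoolP._≟_ NatP._≟_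

open import Data.List.Membership.DecPropositional _≟L_ public using (_∈_; _∈?_)

-- A clause is a finite set of literals, represented by a list
-- (order and repetitions irrelevant: all notions below are set-based).
Clause : Set
Clause = List Literal

_⊆_ : Clause → Clause → Set
C ⊆ D = ∀ {l} → l ∈ C → l ∈ D

_⊂_ : Clause → Clause → Set
C ⊂ D = C ⊆ D × ¬ (D ⊆ C)

_≋_ : Clause → Clause → Set
C ≋ D = C ⊆ D × D ⊆ C

_∈ₛ_ : Clause → List Clause → Set
C ∈ₛ 𝕃 = Any (C ≋_) 𝕃

Trivial : Clause → Set
Trivial C = Σ Literal (λ l → l ∈ C × neg l ∈ C)

_⊆ᵇ_ : Clause → Clause → Bool
C ⊆ᵇ D = all (λ l → does (l ∈? D)) C

_⊂ᵇ_ : Clause → Clause → Bool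
C ⊂ᵇ D = (C ⊆ᵇ D) ∧ not (D ⊆ᵇ C)

nontrivialᵇ : Clause → Bool
nontrivialᵇ C = not (any (λ l → does (neg l ∈? C)) C)

removeSubsumed : List Clause → List Clause
removeSubsumed 𝕃 = filterᵇ (λ C → not (any (λ D → D ⊂ᵇ C) 𝕃)) 𝕃

-- one step: N(ℂ ∪ {C}) from N(ℂ)
step : List Clause → Clause → List Clause
step Ns C = removeSubsumed (filterᵇ nontrivialᵇ
              (concatMap (λ D → map (λ a → D ++ [ neg a ]) C) Ns))

N : List Clause → List Clause
N []       = [ [] ]
N (C ∷ ℂ) = step (N ℂ) C

Assignment : Set
Assignment = ℕ → Bool

satLit : Assignment → Literal → Set
satLit σ (b , x) = σ x ≡ b

satClause : Assignment → Clause → Set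
satClause σ C = Any (satLit σ) C

satCNF : Assignment → List Clause → Set
satCNF σ ℂ = All (satClause σ) ℂ

satNegTerm : Assignment → Clause → Set
satNegTerm σ C = All (λ l → satLit σ (neg l)) C

NegEntails : Clause → List Clause → Set
NegEntails C ℂ = ∀ (σ : Assignment) → satNegTerm σ C → satCNF σ ℂ

-- For non-trivial C and ℂ, ¬C ⊨ ℂ holds iff C contains the complement of some literal of
-- every clause of ℂ: otherwise the assignment making true exactly the variables occurring
-- negatively in C or in the missed clause D satisfies ¬C and falsifies D.  By induction on
-- ℂ, N(ℂ) is an antichain of non-trivial such "hitting" clauses below every non-trivial
-- hitting clause: extending each member by the complement of a literal of the new clause
-- and discarding trivial and subsumed clauses preserves this.  An antichain basis of an
-- upward closed family of non-trivial clauses consists exactly of its minimal elements.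

module Submission where

open import Defs hiding (_∈_)
open import Data.Bool using (true; false; not; T; T?)
open import Data.Bool.Properties using (T-∧; T-≡; not-involutive)
open import Data.List using (List; []; _∷_; _∷ʳ_; _++_; map; concatMap; filterᵇ)
open import Data.List.Membership.Propositional using (_∈_; find; lose)
open import Data.List.Membership.Propositional.Properties
  using (∈-filter⁺; ∈-filter⁻; ∈-map⁺; ∈-map⁻; ∈-concatMap⁺; ∈-concatMap⁻; ∈-++⁺ˡ; ∈-++⁺ʳ; ∈-++⁻)
open import Data.List.Relation.Unary.Any using (Any; here; there; any?)
import Data.List.Relation.Unary.Any as Any
open import Data.List.Relation.Unary.Any.Properties using (any⁺; any⁻)
open import Data.List.Relation.Unary.All using (All; []; _∷_)
import Data.List.Relation.Unary.All as All
open import Data.List.Relation.Unary.All.Properties using (all⁺; all⁻; ¬Any⇒All¬; All¬⇒¬Any)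
open import Data.List.Relation.Unary.AllPairs using (AllPairs)
open import Data.Product using (∃-syntax; _×_; _,_; proj₁; proj₂)
open import Data.Sum using (inj₁; inj₂)
open import Function.Base using (_∘_; id)
open import Function.Bundles using (_⇔_; mk⇔; Equivalence)
open Equivalence using (to; from)
open import Relation.Binary.Core using (Rel)
open import Relation.Binary.Definitions using (Transitive; Decidable)
open import Relation.Binary.Construct.Closure.Reflexive using (ReflClosure; refl; [_])
open import Relation.Binary.PropositionalEquality using (_≡_; refl; cong; subst)
open import Relation.Nullary using (¬_; yes; no; Dec; does)
open import Relation.Nullary.Decidable using (dec-true; dec-false; decidable-stable)
import Relation.Nullary.Decidable as Dec

module _ {a ℓ} {A : Set a} {_<_ : Rel A ℓ}
         (<-irrefl : ∀ {x} → ¬ x < x) (<-trans : Transitive _<_) (_<?_ : Decidable _<_) where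

  private
    _≤_ = ReflClosure _<_

    <-≤-trans : ∀ {x y z} → x < y → y ≤ z → x < z
    <-≤-trans x<y refl    = x<y
    <-≤-trans x<y [ y<z ] = <-trans x<y y<z

    ≤-<-trans : ∀ {x y z} → x ≤ y → y < z → x < z
    ≤-<-trans refl    y<z = y<z
    ≤-<-trans [ x<y ] y<z = <-trans x<y y<z

  minimal-below : ∀ {x} xs → x ∈ xs → ∃[ y ] y ∈ xs × y ≤ x × All (λ z → ¬ z < y) xs
  minimal-below (z ∷ zs) (here refl) with any? (_<? z) zs
  ... | no ∄w<z = z , here refl , refl , <-irrefl ∷ ¬Any⇒All¬ zs ∄w<z
  ... | yes ∃w<z with w , w∈zs , w<z ← find ∃w<z
                 with y , y∈zs , y≤w , y-min ← minimal-below zs w∈zs =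
    y , there y∈zs , [ ≤-<-trans y≤w w<z ] ,
    (λ z<y → <-irrefl (<-trans (<-≤-trans z<y y≤w) w<z)) ∷ y-min
  minimal-below (z ∷ zs) (there x∈zs) with y , y∈zs , y≤x , y-min ← minimal-below zs x∈zs
                                      with z <? y
  ... | no z≮y  = y , there y∈zs , y≤x , z≮y ∷ y-min
  ... | yes z<y = z , here refl , [ <-≤-trans z<y y≤x ] ,
    <-irrefl ∷ All.map (λ w≮y w<z → w≮y (<-trans w<z z<y)) y-min

T-does : ∀ {P : Set} (P? : Dec P) → T (does P?) ⇔ P
T-does (yes p) = mk⇔ (λ _ → p) _
T-does (no ¬p) = mk⇔ (λ ()) ¬p

T-not : ∀ {b} → T (not b) ⇔ (¬ T b)
T-not {false} = mk⇔ (λ _ ()) _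
T-not {true}  = mk⇔ (λ ()) (λ ¬t → ¬t _)

neg-involutive : ∀ l → neg (neg l) ≡ l
neg-involutive (b , x) = cong (_, x) (not-involutive b)

⊆-trans : ∀ {C D E} → C ⊆ D → D ⊆ E → C ⊆ E
⊆-trans C⊆D D⊆E l∈C = D⊆E (C⊆D l∈C)

⊆-⊂-trans : ∀ {C D E} → C ⊆ D → D ⊂ E → C ⊂ E
⊆-⊂-trans C⊆D (D⊆E , E⊈D) = ⊆-trans C⊆D D⊆E , λ E⊆C → E⊈D (⊆-trans E⊆C C⊆D)

⊂-⊆-trans : ∀ {C D E} → C ⊂ D → D ⊆ E → C ⊂ E
⊂-⊆-trans (C⊆D , D⊈C) D⊆E = ⊆-trans C⊆D D⊆E , λ E⊆C → D⊈C (⊆-trans D⊆E E⊆C)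

⊂-trans : Transitive _⊂_
⊂-trans C⊂D D⊂E = ⊂-⊆-trans C⊂D (proj₁ D⊂E)

⊂-irrefl : ∀ {C} → ¬ C ⊂ C
⊂-irrefl (_ , C⊈C) = C⊈C id

⊆-nontrivial : ∀ {C D} → C ⊆ D → ¬ Trivial D → ¬ Trivial C
⊆-nontrivial C⊆D ntD (l , l∈C , l̄∈C) = ntD (l , C⊆D l∈C , C⊆D l̄∈C)

⊆ᵇ⇔⊆ : ∀ {C D} → T (C ⊆ᵇ D) ⇔ C ⊆ D
⊆ᵇ⇔⊆ {C} {D} = mk⇔
  (λ t {l} l∈C → to (T-does (l ∈? D)) (All.lookup (all⁺ (λ l → does (l ∈? D)) C t) l∈C))
  (λ C⊆D → all⁻ (λ l → does (l ∈? D)) (All.tabulate (λ {l} l∈C → from (T-does (l ∈? D)) (C⊆D l∈C))))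

⊂ᵇ⇔⊂ : ∀ {C D} → T (C ⊂ᵇ D) ⇔ C ⊂ D
⊂ᵇ⇔⊂ {C} {D} = mk⇔ reflect reify
  where
  reflect : T (C ⊂ᵇ D) → C ⊂ D
  reflect t with C⊆ᵇD , D⊈ᵇC ← to T-∧ t =
    to ⊆ᵇ⇔⊆ C⊆ᵇD , λ D⊆C → to T-not D⊈ᵇC (from ⊆ᵇ⇔⊆ D⊆C)
  reify : C ⊂ D → T (C ⊂ᵇ D)
  reify (C⊆D , D⊈C) = from T-∧ (from ⊆ᵇ⇔⊆ C⊆D , from T-not (λ t → D⊈C (to ⊆ᵇ⇔⊆ t)))

_⊆?_ : Decidable _⊆_
C ⊆? D = Dec.map ⊆ᵇ⇔⊆ (T? (C ⊆ᵇ D))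

_⊂?_ : Decidable _⊂_
C ⊂? D = Dec.map ⊂ᵇ⇔⊂ (T? (C ⊂ᵇ D))

nontrivialᵇ⇔ : ∀ {C} → T (nontrivialᵇ C) ⇔ (¬ Trivial C)
nontrivialᵇ⇔ {C} = mk⇔
  (λ t trivial → to T-not t (any⁺ complementIn (witness trivial)))
  (λ nt → from T-not (λ t → nt (trivialFrom (any⁻ complementIn C t))))
  where
  complementIn = λ l → does (neg l ∈? C)
  witness : Trivial C → Any (T ∘ complementIn) C
  witness (l , l∈C , l̄∈C) = lose l∈C (from (T-does (neg l ∈? C)) l̄∈C)
  trivialFrom : Any (T ∘ complementIn) C → Trivial C
  trivialFrom any with l , l∈C , t ← find any = l , l∈C , to (T-does (neg l ∈? C)) t

∷ʳ-⊆ : ∀ {D C l} → D ⊆ C → l ∈ C → (D ∷ʳ l) ⊆ C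
∷ʳ-⊆ {D} D⊆C l∈C m with ∈-++⁻ D m
... | inj₁ m∈D       = D⊆C m∈D
... | inj₂ (here refl) = l∈C

∈-removeSubsumed⁻ : ∀ {C L} → C ∈ removeSubsumed L → C ∈ L × All (λ D → ¬ D ⊂ C) L
∈-removeSubsumed⁻ {C} {L} C∈ with C∈L , unsubsumed ← ∈-filter⁻ (T? ∘ _) C∈ =
  C∈L , All.map (λ ¬t D⊂C → ¬t (from ⊂ᵇ⇔⊂ D⊂C))
                (¬Any⇒All¬ L (λ t → to T-not unsubsumed (any⁺ (_⊂ᵇ C) t)))

∈-removeSubsumed⁺ : ∀ {C L} → C ∈ L → All (λ D → ¬ D ⊂ C) L → C ∈ removeSubsumed L
∈-removeSubsumed⁺ {C} {L} C∈L minimal =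
  ∈-filter⁺ (T? ∘ _) C∈L (from T-not (λ t →
    All¬⇒¬Any (All.map (λ ¬D⊂C t → ¬D⊂C (to ⊂ᵇ⇔⊂ t)) minimal) (any⁻ (_⊂ᵇ C) L t)))

removeSubsumed-covers : ∀ {C L} → C ∈ L → ∃[ E ] E ∈ removeSubsumed L × E ⊆ C
removeSubsumed-covers {L = L} C∈L
  with E , E∈L , E≤C , E-min ← minimal-below ⊂-irrefl ⊂-trans _⊂?_ L C∈L =
  E , ∈-removeSubsumed⁺ E∈L E-min , ≤⇒⊆ E≤C
  where
  ≤⇒⊆ : ∀ {E C} → ReflClosure _⊂_ E C → E ⊆ C
  ≤⇒⊆ refl      = id
  ≤⇒⊆ [ E⊂C ] = proj₁ E⊂C

extensions : List Clause → Clause → List Clause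
extensions L C = concatMap (λ D → map (λ a → D ∷ʳ neg a) C) L

∈-extensions⁻ : ∀ {E L C} → E ∈ extensions L C → ∃[ D ] ∃[ a ] D ∈ L × a ∈ C × E ≡ D ∷ʳ neg a
∈-extensions⁻ {C = C} E∈
  with D , D∈L , E∈D·C ← find (∈-concatMap⁻ (λ D → map (λ a → D ∷ʳ neg a) C) E∈)
  with a , a∈C , E≡ ← ∈-map⁻ (λ a → D ∷ʳ neg a) E∈D·C =
  D , a , D∈L , a∈C , E≡

∈-extensions⁺ : ∀ {D a L C} → D ∈ L → a ∈ C → D ∷ʳ neg a ∈ extensions L C
∈-extensions⁺ {D} {C = C} D∈L a∈C =
  ∈-concatMap⁺ (λ D → map (λ a → D ∷ʳ neg a) C) (lose D∈L (∈-map⁺ (λ a → D ∷ʳ neg a) a∈C))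

Hits : Clause → Clause → Set
Hits C D = Any (λ a → neg a ∈ C) D

Hits-mono : ∀ {C E D} → C ⊆ E → Hits C D → Hits E D
Hits-mono C⊆E = Any.map C⊆E

hits⇒negEntails : ∀ {C ℂ} → All (Hits C) ℂ → NegEntails C ℂ
hits⇒negEntails hits σ σ⊨¬C =
  All.map (Any.map (λ {a} ā∈C → subst (satLit σ) (neg-involutive a) (All.lookup σ⊨¬C ā∈C))) hits

countermodel : Clause → Assignment
countermodel C x = does ((false , x) ∈? C)

module _ {C D : Clause} (ntC : ¬ Trivial C) (ntD : ¬ Trivial D) (¬hits : ¬ Hits C D) where

  private
    σ = countermodel (C ++ D)

  countermodel-⊨¬ : satNegTerm σ C
  countermodel-⊨¬ = All.tabulate sat
    where
    sat : ∀ {l} → l ∈ C → satLit σ (neg l)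
    sat {true  , x} l∈C = dec-false ((false , x) ∈? C ++ D) x̄∉
      where
      x̄∉ : ¬ (false , x) ∈ C ++ D
      x̄∉ x̄∈ with ∈-++⁻ C x̄∈
      ... | inj₁ x̄∈C = ntC ((true , x) , l∈C , x̄∈C)
      ... | inj₂ x̄∈D = ¬hits (lose x̄∈D l∈C)
    sat {false , x} l∈C = dec-true ((false , x) ∈? C ++ D) (∈-++⁺ˡ l∈C)

  countermodel-⊭ : ¬ satClause σ D
  countermodel-⊭ σ⊨D with find σ⊨D
  ... | (true , x) , a∈D , σx≡true
      with ∈-++⁻ C (to (T-does ((false , x) ∈? C ++ D)) (from T-≡ σx≡true))
  ...   | inj₁ x̄∈C = ¬hits (lose a∈D x̄∈C)
  ...   | inj₂ x̄∈D = ntD ((true , x) , a∈D , x̄∈D)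
  countermodel-⊭ σ⊨D | (false , x) , a∈D , σx≡false =
    subst T σx≡false (from (T-does ((false , x) ∈? C ++ D)) (∈-++⁺ʳ C a∈D))

negEntails⇒hits : ∀ {C ℂ} → ¬ Trivial C → All (¬_ ∘ Trivial) ℂ → NegEntails C ℂ → All (Hits C) ℂ
negEntails⇒hits {C} ntC ntℂ entails = All.tabulate λ {D} D∈ℂ →
  decidable-stable (any? (λ a → neg a ∈? C) D) λ ¬hits →
    countermodel-⊭ ntC (All.lookup ntℂ D∈ℂ) ¬hits
      (All.lookup (entails _ (countermodel-⊨¬ ntC (All.lookup ntℂ D∈ℂ) ¬hits)) D∈ℂ)

record HittingBasis (ℂ L : List Clause) : Set where
  field
    hitting   : ∀ {E} → E ∈ L → ¬ Trivial E × All (Hits E) ℂ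
    covers    : ∀ {C} → ¬ Trivial C → All (Hits C) ℂ → ∃[ E ] E ∈ L × E ⊆ C
    antichain : ∀ {E G} → E ∈ L → G ∈ L → ¬ G ⊂ E

open HittingBasis

hittingBasis-[] : HittingBasis [] (N [])
hittingBasis-[] .hitting (here refl)             = (λ ()) , []
hittingBasis-[] .covers _ _                      = [] , here refl , λ ()
hittingBasis-[] .antichain (here refl) (here refl) = ⊂-irrefl

hittingBasis-step : ∀ {ℂ L C} → HittingBasis ℂ L → HittingBasis (C ∷ ℂ) (step L C)
hittingBasis-step {ℂ} {L} {C} basis = record { hitting = hitting′ ; covers = covers′ ; antichain = antichain′ }
  where
  nontrivialExtensions : List Clause
  nontrivialExtensions = filterᵇ nontrivialᵇ (extensions L C)

  hitting′ : ∀ {E} → E ∈ step L C → ¬ Trivial E × All (Hits E) (C ∷ ℂ)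
  hitting′ E∈ with E∈F , _ ← ∈-removeSubsumed⁻ E∈
              with E∈ext , ntE ← ∈-filter⁻ (T? ∘ nontrivialᵇ) E∈F
              with D , a , D∈L , a∈C , refl ← ∈-extensions⁻ E∈ext =
    to nontrivialᵇ⇔ ntE ,
    lose a∈C (∈-++⁺ʳ D (here refl)) ∷ All.map (Hits-mono ∈-++⁺ˡ) (proj₂ (basis .hitting D∈L))

  covers′ : ∀ {C′} → ¬ Trivial C′ → All (Hits C′) (C ∷ ℂ) → ∃[ E ] E ∈ step L C × E ⊆ C′
  covers′ ntC′ (hitsC ∷ hitsℂ)
    with a , a∈C , ā∈C′ ← find hitsC
    with D , D∈L , D⊆C′ ← basis .covers ntC′ hitsℂ
    with E , E∈ , E⊆Dā ← removeSubsumed-covers {L = nontrivialExtensions}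
           (∈-filter⁺ (T? ∘ nontrivialᵇ) (∈-extensions⁺ D∈L a∈C)
                      (from nontrivialᵇ⇔ (⊆-nontrivial (∷ʳ-⊆ D⊆C′ ā∈C′) ntC′))) =
    E , E∈ , ⊆-trans E⊆Dā (∷ʳ-⊆ D⊆C′ ā∈C′)

  antichain′ : ∀ {E G} → E ∈ step L C → G ∈ step L C → ¬ G ⊂ E
  antichain′ E∈ G∈ =
    All.lookup (proj₂ (∈-removeSubsumed⁻ {L = nontrivialExtensions} E∈))
               (proj₁ (∈-removeSubsumed⁻ {L = nontrivialExtensions} G∈))

N-hittingBasis : ∀ ℂ → HittingBasis ℂ (N ℂ)
N-hittingBasis []      = hittingBasis-[]
N-hittingBasis (C ∷ ℂ) = hittingBasis-step (N-hittingBasis ℂ)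

NegPrimeImplicant : Clause → List Clause → Set
NegPrimeImplicant C ℂ = ¬ Trivial C × NegEntails C ℂ × ((C′ : Clause) → C′ ⊂ C → ¬ NegEntails C′ ℂ)

module _ {ℂ L : List Clause} (ntℂ : All (¬_ ∘ Trivial) ℂ) (basis : HittingBasis ℂ L) where

  ∈ₛ⇒negPrimeImplicant : ∀ {C} → C ∈ₛ L → NegPrimeImplicant C ℂ
  ∈ₛ⇒negPrimeImplicant {C} C∈ₛL with E , E∈L , C⊆E , E⊆C ← find C∈ₛL
                                 with ntE , hitsE ← basis .hitting E∈L =
    ntC , hits⇒negEntails (All.map (Hits-mono E⊆C) hitsE) , prime
    where
    ntC = ⊆-nontrivial C⊆E ntE
    prime : (C′ : Clause) → C′ ⊂ C → ¬ NegEntails C′ ℂ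
    prime C′ C′⊂C entails
      with ntC′ ← ⊆-nontrivial (proj₁ C′⊂C) ntC
      with G , G∈L , G⊆C′ ← basis .covers ntC′ (negEntails⇒hits ntC′ ntℂ entails) =
      basis .antichain E∈L G∈L (⊆-⊂-trans G⊆C′ (⊂-⊆-trans C′⊂C C⊆E))

  negPrimeImplicant⇒∈ₛ : ∀ {C} → NegPrimeImplicant C ℂ → C ∈ₛ L
  negPrimeImplicant⇒∈ₛ {C} (ntC , entails , prime)
    with E , E∈L , E⊆C ← basis .covers ntC (negEntails⇒hits ntC ntℂ entails) =
    lose E∈L (C⊆E , E⊆C)
    where
    C⊆E : C ⊆ E
    C⊆E = decidable-stable (C ⊆? E) λ C⊈E →
      prime E (E⊆C , C⊈E) (hits⇒negEntails (proj₂ (basis .hitting E∈L)))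

proposition3p4 : (ℂ : List Clause) → All (λ D → ¬ Trivial D) ℂ → AllPairs (λ D E → ¬ (D ≋ E)) ℂ →
    (C : Clause) →
    (C ∈ₛ N ℂ) ⇔ ((¬ Trivial C) × NegEntails C ℂ × ((C′ : Clause) → C′ ⊂ C → ¬ NegEntails C′ ℂ))
proposition3p4 ℂ ntℂ _ C =
  mk⇔ (∈ₛ⇒negPrimeImplicant ntℂ basis) (negPrimeImplicant⇒∈ₛ ntℂ basis)
  where
  basis = N-hittingBasis ℂ
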